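{- Let $(W,S)$ be a simply-laced triangle-free Coxeter system and let $\boldsymbol{\varphi} = s t_1 s t_2 \cdots s t_{r-1} s t_r s$ be a Fibonacci link of rank $r \geq 2$. Let $\boldsymbol{\varphi}' := s t_1 s t_2 \cdots s t_{r-2} s$ denote the expression obtained from $\boldsymbol{\varphi}$ by deleting its rightmost four letters, and let $\Sigma : [\boldsymbol{\varphi}'] \to [\boldsymbol{\varphi}]$ be the function that appends the letters $t_{r-1} t_r s t_r$ on the right of each element of $[\boldsymbol{\varphi}']$. Then $\Sigma$ is an isometric embedding of the braid graph $B(\boldsymbol{\varphi}')$ into the braid graph $B(\boldsymbol{\varphi})$. In particular, $\operatorname{im}(\Sigma) = Y_{\boldsymbol{\varphi}}$ and $B(\boldsymbol{\varphi}')$ is isomorphic to the induced subgraph $B(\boldsymbol{\varphi})[Y_{\boldsymbol{\varphi}}]$.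
   Context: $(W,S)$ is a Coxeter system with $m(s,t)\le 3$ for all $s,t\in S$ (simply laced) whose Coxeter graph has no three-cycles (triangle free). A braid move replaces a subword $sts$ with $m(s,t)=3$ by $tst$. For a reduced expression $\boldsymbol{\alpha}$, its braid class $[\boldsymbol{\alpha}]$ is the set of reduced expressions obtainable from $\boldsymbol{\alpha}$ by sequences of braid moves, and the braid graph $B(\boldsymbol{\alpha})$ has vertex set $[\boldsymbol{\alpha}]$ with edges joining expressions differing by a single braid move; distances are graph (geodesic) distances. For a reduced expression $\boldsymbol{\alpha}=s_{x_1}\cdots s_{x_m}$, an interval of positions $\{i,i+1,i+2\}$ is a braid shadow of $\boldsymbol{\alpha}$ if $s_{x_i}=s_{x_{i+2}}$ and $m(s_{x_i},s_{x_{i+1}})=3$. A link of rank $r$ is a reduced expression with $2r+1$ letters such that the set of braid shadows occurring among all elements of its braid class is exactly $\{\{1,2,3\},\{3,4,5\},\dots,\{2r-1,2r,2r+1\}\}$. A Fibonacci link is a link $\boldsymbol{\varphi}$ for which every one of these intervals is already a braid shadow of $\boldsymbol{\varphi}$ itself; such a link has the form $s t_1 s t_2 \cdots s t_r s$ with $m(s,t_i)=3$ for all $i$ and $m(t_i,t_j)=2$ whenever $t_i\neq t_j$. Finally, $Y_{\boldsymbol{\varphi}}$ is the set of $\boldsymbol{\beta}\in[\boldsymbol{\varphi}]$ whose letter in position $2r$ differs from the letter in position $2r$ of $\boldsymbol{\varphi}$ (i.e., differs from $t_r$). The map $\Sigma$ is well defined (its values lie in $[\boldsymbol{\varphi}]$).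 -}

module Defs where

open import Data.Nat using (ℕ; zero; suc; _+_; _*_; _≤_; _<_)
open import Data.List using (List; []; _∷_; _++_; length; concat; replicate)
open import Data.Maybe using (Maybe; just; nothing)
open import Data.Product using (Σ; ∃; _×_; _,_)
open import Data.Empty using (⊥)
open import Relation.Nullary using (¬_)
open import Relation.Binary.PropositionalEquality using (_≡_)
open import Relation.Binary.Construct.Closure.Equivalence using (EqClosure)
open import Relation.Binary.Construct.Closure.ReflexiveTransitive using (Star)

-- Coxeter matrix on an arbitrary generating set S (m s t = order of st).
record IsCoxeterMatrix {S : Set} (m : S → S → ℕ) : Set where
  field
    diag    : ∀ s → m s s ≡ 1
    sym     : ∀ s t → m s t ≡ m t s
    offdiag : ∀ s t → ¬ (s ≡ t) → 2 ≤ m s t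

SimplyLaced : {S : Set} → (S → S → ℕ) → Set
SimplyLaced {S} m = ∀ (s t : S) → m s t ≤ 3

TriangleFree : {S : Set} → (S → S → ℕ) → Set
TriangleFree {S} m = ∀ (a b c : S) → m a b ≡ 3 → m b c ≡ 3 → m a c ≡ 3 → ⊥

module _ {S : Set} (m : S → S → ℕ) where

  altPow : S → S → ℕ → List S
  altPow a b k = concat (replicate k (a ∷ b ∷ []))

  data CoxStep : List S → List S → Set where
    ins : ∀ (u v : List S) (a b : S) → CoxStep (u ++ v) (u ++ altPow a b (m a b) ++ v)

  -- equality in W of the elements represented by two words
  CoxEq : List S → List S → Set
  CoxEq = EqClosure CoxStep

  Reduced : List S → Set
  Reduced α = ∀ β → CoxEq α β → length α ≤ length β

  data BraidStep : List S → List S → Set where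
    braid : ∀ (u v : List S) (a b : S) → m a b ≡ 3 →
            BraidStep (u ++ a ∷ b ∷ a ∷ [] ++ v) (u ++ b ∷ a ∷ b ∷ [] ++ v)

  BraidClass : List S → List S → Set
  BraidClass = Star BraidStep

  data Walk : ℕ → List S → List S → Set where
    here  : ∀ {α} → Walk zero α α
    there : ∀ {k α β γ} → BraidStep α β → Walk k β γ → Walk (suc k) α γ

  Dist : List S → List S → ℕ → Set
  Dist α β k = Walk k α β × (∀ j → Walk j α β → k ≤ j)

  -- letter at 1-indexed position p
  at : List S → ℕ → Maybe S
  at [] _ = nothing
  at (x ∷ xs) zero = nothing
  at (x ∷ xs) (suc zero) = just x
  at (x ∷ xs) (suc (suc p)) = at xs (suc p)

  Shadow : List S → ℕ → Set
  Shadow α i = Σ S λ a → Σ S λ b →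
    (at α i ≡ just a) × (at α (suc i) ≡ just b) × (at α (suc (suc i)) ≡ just a) × (m a b ≡ 3)

  Link : ℕ → List S → Set
  Link r α = Reduced α × (length α ≡ 2 * r + 1) ×
    (∀ i → ((∃ λ β → BraidClass α β × Shadow β i) → ∃ λ j → j < r × i ≡ 2 * j + 1)
         × ((∃ λ j → j < r × i ≡ 2 * j + 1) → ∃ λ β → BraidClass α β × Shadow β i))

  FibonacciLink : ℕ → List S → Set
  FibonacciLink r φ = Link r φ × (∀ j → j < r → Shadow φ (2 * j + 1))

fibWord : {S : Set} → S → List S → List S
fibWord s [] = s ∷ []
fibWord s (t ∷ ts) = s ∷ t ∷ fibWord s ts

-- The braid class of s t₁ s ⋯ tₙ s is parametrised by codes K ∈ {0,1}ⁿ: Kᵢ = 1 when the block s tᵢ s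
-- has been replaced by tᵢ s tᵢ. The tᵢ are all joined to s, consecutive ones are distinct (there is no
-- braid shadow at an even position), and the Coxeter graph has no triangles; together these force every
-- braid move to change exactly one bit of the code. Σ appends the bits 01, and its image consists of the
-- codes ending in 01, which are recognised by the letter at position 2r. Forgetting the last two bits
-- sends a walk in B(φ) to a walk in B(φ′) that is no longer, so Σ preserves distances, and braid moves
-- are exactly the pairs at distance 1.
module Submission where

open import Defs
open import Data.Nat using (ℕ; zero; suc; _+_; _*_; _≤_; _<_; z≤n; s≤s)
open import Data.Nat.Properties using (≤-trans; ≤-antisym; m≤n⇒m≤1+n; +-comm; *-comm; *-distribʳ-+; even≢odd)
open import Data.Bool using (Bool; true; false; not)
open import Data.List using (List; []; _∷_; _++_; length; take)
open import Data.List.Properties using (++-assoc; ++-cancelˡ; ∷-injectiveˡ; length-++)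
open import Data.List.Relation.Unary.All using (All; []; _∷_)
open import Data.List.Relation.Unary.All.Properties using (++⁻ˡ; ++⁻ʳ)
open import Data.List.Relation.Unary.Linked using (Linked; []; [-]; _∷_; head; tail)
open import Data.Maybe using (just)
open import Data.Maybe.Properties using (just-injective)
open import Data.Product using (∃; ∃₂; _×_; _,_; proj₁; proj₂)
open import Data.Sum using (_⊎_; inj₁; inj₂)
import Data.Sum as Sum
open import Data.Empty using (⊥-elim)
open import Relation.Nullary using (¬_)
open import Relation.Binary.PropositionalEquality
open import Relation.Binary.Construct.Closure.ReflexiveTransitive using (ε; _◅_; gmap)

data Toggle : List Bool → List Bool → Set where
  here  : ∀ {b K} → Toggle (b ∷ K) (not b ∷ K)
  there : ∀ {b K K′} → Toggle K K′ → Toggle (b ∷ K) (b ∷ K′)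

Toggle-take : ∀ n {K K′} → Toggle K K′ → Toggle (take n K) (take n K′) ⊎ take n K ≡ take n K′
Toggle-take zero    _         = inj₂ refl
Toggle-take (suc n) here      = inj₁ here
Toggle-take (suc n) (there t) = Sum.map there (cong (_ ∷_)) (Toggle-take n t)

take-length-++ : ∀ {A : Set} (xs : List A) {ys} → take (length xs) (xs ++ ys) ≡ xs
take-length-++ []       = refl
take-length-++ (x ∷ xs) = cong (x ∷_) (take-length-++ xs)

Linked-++⁻ˡ : ∀ {A : Set} {R : A → A → Set} xs {ys} → Linked R (xs ++ ys) → Linked R xs
Linked-++⁻ˡ []           _       = []
Linked-++⁻ˡ (x ∷ [])     _       = [-]
Linked-++⁻ˡ (x ∷ y ∷ xs) (r ∷ l) = r ∷ Linked-++⁻ˡ (y ∷ xs) l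

fibWord-++ : ∀ {S : Set} (s : S) ts u us → fibWord s (ts ++ u ∷ us) ≡ fibWord s ts ++ u ∷ fibWord s us
fibWord-++ s []       u us = refl
fibWord-++ s (t ∷ ts) u us = cong (λ w → s ∷ t ∷ w) (fibWord-++ s ts u us)

module _ {S : Set} (m : S → S → ℕ) where

  BraidStep-∷ : ∀ x {γ δ} → BraidStep m γ δ → BraidStep m (x ∷ γ) (x ∷ δ)
  BraidStep-∷ x (braid u v p q e) = braid (x ∷ u) v p q e

  BraidStep-++ˡ : ∀ xs {γ δ} → BraidStep m γ δ → BraidStep m (xs ++ γ) (xs ++ δ)
  BraidStep-++ˡ []       st = st
  BraidStep-++ˡ (x ∷ xs) st = BraidStep-∷ x (BraidStep-++ˡ xs st)

  BraidStep-++ʳ : ∀ w {γ δ} → BraidStep m γ δ → BraidStep m (γ ++ w) (δ ++ w)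
  BraidStep-++ʳ w (braid u v p q e) =
    subst₂ (BraidStep m) (sym (++-assoc u (p ∷ q ∷ p ∷ v) w)) (sym (++-assoc u (q ∷ p ∷ q ∷ v) w))
      (braid u (v ++ w) p q e)

  BraidClass-++ˡ : ∀ xs {γ δ} → BraidClass m γ δ → BraidClass m (xs ++ γ) (xs ++ δ)
  BraidClass-++ˡ xs = gmap (xs ++_) (BraidStep-++ˡ xs)

  BraidClass-++ʳ : ∀ w {γ δ} → BraidClass m γ δ → BraidClass m (γ ++ w) (δ ++ w)
  BraidClass-++ʳ w = gmap (_++ w) (BraidStep-++ʳ w)

  Walk-++ʳ : ∀ w {k γ δ} → Walk m k γ δ → Walk m k (γ ++ w) (δ ++ w)
  Walk-++ʳ w here         = here
  Walk-++ʳ w (there st p) = there (BraidStep-++ʳ w st) (Walk-++ʳ w p)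

  Dist-transfer : ∀ {α β α′ β′} →
    (∀ {j} → Walk m j α β → Walk m j α′ β′) →
    (∀ {j} → Walk m j α′ β′ → ∃ λ j′ → j′ ≤ j × Walk m j′ α β) →
    ∀ k → (Dist m α β k → Dist m α′ β′ k) × (Dist m α′ β′ k → Dist m α β k)
  Dist-transfer lift project k = to , from
    where
      to : Dist m _ _ k → Dist m _ _ k
      to (p , minimal) = lift p , λ j q → let (j′ , j′≤j , q′) = project q in ≤-trans (minimal j′ q′) j′≤j
      from : Dist m _ _ k → Dist m _ _ k
      from (p , minimal) with project p
      ... | j′ , j′≤k , p′ with ≤-antisym j′≤k (minimal j′ (lift p′))
      ... | refl = p′ , λ j q → minimal j (lift q)

  Dist1⇒BraidStep : ∀ {γ δ} → Dist m γ δ 1 → BraidStep m γ δ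
  Dist1⇒BraidStep (there st here , _) = st

  module _ (cox : IsCoxeterMatrix m) where

    diag≢3 : ∀ x → m x x ≢ 3
    diag≢3 x e with trans (sym (IsCoxeterMatrix.diag cox x)) e
    ... | ()

    BraidStep⇒≢ : ∀ {γ δ} → BraidStep m γ δ → γ ≢ δ
    BraidStep⇒≢ (braid u v p q e) eq =
      diag≢3 q (subst (λ x → m x q ≡ 3) (∷-injectiveˡ (++-cancelˡ u _ _ eq)) e)

    BraidStep⇒Dist1 : ∀ {γ δ} → BraidStep m γ δ → Dist m γ δ 1
    BraidStep⇒Dist1 st = there st here , atLeast1
      where
        atLeast1 : ∀ j → Walk m j _ _ → 1 ≤ j
        atLeast1 zero    here = ⊥-elim (BraidStep⇒≢ st refl)
        atLeast1 (suc j) _    = s≤s z≤n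

Joined : {S : Set} → (S → S → ℕ) → S → List S → Set
Joined m s = All (λ t → m s t ≡ 3)

-- Flips s x ts K γ: γ arises from x t₁ s t₂ s ⋯ tₙ s by the braid moves s tᵢ s ↦ tᵢ s tᵢ at the
-- blocks i with Kᵢ = true. A move at block i turns the first letter of block i+1 into tᵢ, so that
-- letter is an index, and a block can only be moved while it still starts with s.

data Flips {S : Set} (s : S) : S → List S → List Bool → List S → Set where
  end  : ∀ {x} → Flips s x [] [] (x ∷ [])
  keep : ∀ {x t ts K γ} → Flips s s ts K γ → Flips s x (t ∷ ts) (false ∷ K) (x ∷ t ∷ γ)
  flip : ∀ {t ts K γ} → Flips s t ts K γ → Flips s s (t ∷ ts) (true ∷ K) (t ∷ s ∷ γ)

module _ {S : Set} {s : S} where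

  Flips-length : ∀ {x ts K γ} → Flips s x ts K γ → length K ≡ length ts
  Flips-length end      = refl
  Flips-length (keep c) = cong suc (Flips-length c)
  Flips-length (flip c) = cong suc (Flips-length c)

  Flips-word-unique : ∀ {x ts K γ δ} → Flips s x ts K γ → Flips s x ts K δ → γ ≡ δ
  Flips-word-unique end      end      = refl
  Flips-word-unique (keep c) (keep d) = cong (λ w → _ ∷ _ ∷ w) (Flips-word-unique c d)
  Flips-word-unique (flip c) (flip d) = cong (λ w → _ ∷ _ ∷ w) (Flips-word-unique c d)

  Flips-fibWord : ∀ ts → ∃ λ K → Flips s s ts K (fibWord s ts)
  Flips-fibWord []       = [] , end
  Flips-fibWord (t ∷ ts) = _ , keep (proj₂ (Flips-fibWord ts))

  Flips-take : ∀ ts {us x K γ} → Flips s x (ts ++ us) K γ → ∃ λ α → Flips s x ts (take (length ts) K) α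
  Flips-take []       _        = _ , end
  Flips-take (t ∷ ts) (keep c) = _ , keep (proj₂ (Flips-take ts c))
  Flips-take (t ∷ ts) (flip c) = _ , flip (proj₂ (Flips-take ts c))

  module _ {a b : S} where

    Flips-Σ : ∀ {x ts K α} → Flips s x ts K α →
      Flips s x (ts ++ a ∷ b ∷ []) (K ++ false ∷ true ∷ []) (α ++ a ∷ b ∷ s ∷ b ∷ [])
    Flips-Σ end      = keep (flip end)
    Flips-Σ (keep c) = keep (Flips-Σ c)
    Flips-Σ (flip c) = flip (Flips-Σ c)

    -- Positions are written as 4 + n * 2, suc (j * 2), 2 + k * 2 so that removing a leading block
    -- s tᵢ shifts them by 2 definitionally.
    Flips-Σ-at : ∀ {x ts K α} (m : S → S → ℕ) → Flips s x ts K α →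
      at m (α ++ a ∷ b ∷ s ∷ b ∷ []) (4 + length ts * 2) ≡ just s
    Flips-Σ-at m end      = refl
    Flips-Σ-at m (keep c) = Flips-Σ-at m c
    Flips-Σ-at m (flip c) = Flips-Σ-at m c

module _ {S : Set} {m : S → S → ℕ} (cox : IsCoxeterMatrix m) (s : S) where

  Flips-code-unique : ∀ {x ts K K′ γ} → Joined m s ts → Flips s x ts K γ → Flips s x ts K′ γ → K ≡ K′
  Flips-code-unique _       end      end      = refl
  Flips-code-unique (_ ∷ j) (keep c) (keep d) = cong (false ∷_) (Flips-code-unique j c d)
  Flips-code-unique (_ ∷ j) (flip c) (flip d) = cong (true ∷_) (Flips-code-unique j c d)
  Flips-code-unique (h ∷ _) (keep c) (flip d) = ⊥-elim (diag≢3 m cox s h)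
  Flips-code-unique (h ∷ _) (flip c) (keep d) = ⊥-elim (diag≢3 m cox s h)

  Flips-relabel : ∀ {y ts K v} → Joined m s ts → Flips s y ts K (y ∷ v) → ∀ z → Flips s z ts K (z ∷ v)
  Flips-relabel _       end      z = end
  Flips-relabel _       (keep c) z = keep c
  Flips-relabel (h ∷ _) (flip c) z = ⊥-elim (diag≢3 m cox s h)

  Flips-swapHead : ∀ {t ts K γ δ} → m s t ≡ 3 → Flips s s ts K γ → Flips s t ts K δ →
    ∃ λ w → γ ≡ s ∷ w × δ ≡ t ∷ w
  Flips-swapHead _ end      end      = [] , refl , refl
  Flips-swapHead _ (keep c) (keep d) = _ , refl , cong (λ w → _ ∷ _ ∷ w) (sym (Flips-word-unique c d))
  Flips-swapHead h (flip c) (flip d) = ⊥-elim (diag≢3 m cox s h)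

  Toggle⇒BraidStep : ∀ {x ts K K′ γ δ} → Joined m s ts →
    Flips s x ts K γ → Flips s x ts K′ δ → Toggle K K′ → BraidStep m γ δ
  Toggle⇒BraidStep (h ∷ _) (keep c) (flip d) here with Flips-swapHead h c d
  ... | w , refl , refl = braid [] w s _ h
  Toggle⇒BraidStep (h ∷ _) (flip c) (keep d) here with Flips-swapHead h d c
  ... | w , refl , refl = braid [] w _ s (trans (IsCoxeterMatrix.sym cox _ s) h)
  Toggle⇒BraidStep (_ ∷ j) (keep c) (keep d) (there t) = BraidStep-++ˡ m (_ ∷ _ ∷ []) (Toggle⇒BraidStep j c d t)
  Toggle⇒BraidStep (_ ∷ j) (flip c) (flip d) (there t) = BraidStep-++ˡ m (_ ∷ _ ∷ []) (Toggle⇒BraidStep j c d t)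

  -- A move straddling two blocks would need tᵢ = tᵢ₊₁, and a move on a block of the form
  -- tᵢ₋₁ tᵢ tᵢ₊₁ would need the triangle s, tᵢ, tᵢ₊₁ in the Coxeter graph.
  BraidStep⇒Toggle : ∀ {x ts K γ δ} → TriangleFree m → Joined m s ts → Linked _≢_ ts →
    BraidStep m γ δ → Flips s x ts K γ → ∃ λ K′ → Toggle K K′ × Flips s x ts K′ δ
  BraidStep⇒Toggle _  _               _ (braid [] v p q e) (keep end)        = _ , here , flip end
  BraidStep⇒Toggle _  _               _ (braid [] v p q e) (keep (keep c))   = _ , here , flip (keep c)
  BraidStep⇒Toggle tf (hq ∷ hp ∷ _)   _ (braid [] v p q e) (keep (flip c))   = ⊥-elim (tf s p q hp e hq)
  BraidStep⇒Toggle _  (_ ∷ j)         _ (braid [] v p q e) (flip c)          = _ , here , keep (Flips-relabel j c s)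
  BraidStep⇒Toggle _  _               l (braid (_ ∷ []) v p q e) (keep (keep c)) = ⊥-elim (head l refl)
  BraidStep⇒Toggle _  (h ∷ _)         _ (braid (_ ∷ []) v p q e) (keep (flip c)) = ⊥-elim (diag≢3 m cox s h)
  BraidStep⇒Toggle _  (_ ∷ h ∷ _)     _ (braid (_ ∷ []) v p q e) (flip (keep c)) = ⊥-elim (diag≢3 m cox s h)
  BraidStep⇒Toggle _  (h ∷ _)         _ (braid (_ ∷ []) v p q e) (flip (flip c)) = ⊥-elim (diag≢3 m cox s h)
  BraidStep⇒Toggle tf (_ ∷ j) l (braid (_ ∷ _ ∷ u) v p q e) (keep c)
    with BraidStep⇒Toggle tf j (tail l) (braid u v p q e) c
  ... | _ , t , c′ = _ , there t , keep c′
  BraidStep⇒Toggle tf (_ ∷ j) l (braid (_ ∷ _ ∷ u) v p q e) (flip c)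
    with BraidStep⇒Toggle tf j (tail l) (braid u v p q e) c
  ... | _ , t , c′ = _ , there t , flip c′

  BraidClass-Flips : ∀ {x ts K γ δ} → TriangleFree m → Joined m s ts → Linked _≢_ ts →
    BraidClass m γ δ → Flips s x ts K γ → ∃ λ K′ → Flips s x ts K′ δ
  BraidClass-Flips tf j l ε          c = _ , c
  BraidClass-Flips tf j l (st ◅ sts) c with BraidStep⇒Toggle tf j l st c
  ... | _ , _ , c′ = BraidClass-Flips tf j l sts c′

  Flips⇒BraidClass : ∀ {ts K γ} → Joined m s ts → Flips s s ts K γ → BraidClass m (fibWord s ts) γ
  Flips⇒BraidClass _           end             = ε
  Flips⇒BraidClass (_ ∷ j)     (keep c)        = BraidClass-++ˡ m (_ ∷ _ ∷ []) (Flips⇒BraidClass j c)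
  Flips⇒BraidClass (h ∷ [])    (flip end)      = braid [] [] s _ h ◅ ε
  Flips⇒BraidClass (h ∷ _ ∷ j) (flip (keep c)) =
    braid [] _ s _ h ◅ BraidClass-++ˡ m (_ ∷ _ ∷ _ ∷ _ ∷ []) (Flips⇒BraidClass j c)
  Flips⇒BraidClass (h ∷ _)     (flip (flip c)) = ⊥-elim (diag≢3 m cox s h)

  -- Each move toggles one bit of the code; toggles beyond the first length L bits are dropped.
  Walk-project : ∀ L {us j γ γ′ K K′ α α′} → TriangleFree m → Joined m s (L ++ us) → Linked _≢_ (L ++ us) →
    Walk m j γ γ′ → Flips s s (L ++ us) K γ → Flips s s (L ++ us) K′ γ′ →
    Flips s s L (take (length L) K) α → Flips s s L (take (length L) K′) α′ →
    ∃ λ j′ → j′ ≤ j × Walk m j′ α α′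
  Walk-project L tf j l here c c′ d d′ with Flips-code-unique j c c′
  ... | refl = 0 , z≤n , subst (Walk m 0 _) (Flips-word-unique d d′) here
  Walk-project L tf j l (there st p) c c′ d d′ with BraidStep⇒Toggle tf j l st c
  ... | _ , t , c″ with Flips-take L c″
  ... | _ , d″ with Walk-project L tf j l p c″ c′ d″ d′ | Toggle-take (length L) t
  ... | j″ , j″≤j , p′ | inj₁ t′ =
    suc j″ , s≤s j″≤j , there (Toggle⇒BraidStep (++⁻ˡ L j) d d″ t′) p′
  ... | j″ , j″≤j , p′ | inj₂ eq =
    j″ , m≤n⇒m≤1+n j″≤j ,
    subst (λ α₀ → Walk m j″ α₀ _) (Flips-word-unique d″ (subst (λ K₀ → Flips s s L K₀ _) eq d)) p′

  Flips-Σ⁻¹ : ∀ {a b} → m s a ≡ 3 → ∀ ts {x K γ} → Flips s x (ts ++ a ∷ b ∷ []) K γ →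
    at m γ (4 + length ts * 2) ≢ just b →
    ∃₂ λ K₁ α → Flips s x ts K₁ α × γ ≡ α ++ a ∷ b ∷ s ∷ b ∷ []
  Flips-Σ⁻¹ _ []       (keep (keep end)) b≢b = ⊥-elim (b≢b refl)
  Flips-Σ⁻¹ _ []       (keep (flip end)) _   = [] , _ , end , refl
  Flips-Σ⁻¹ _ []       (flip (keep end)) b≢b = ⊥-elim (b≢b refl)
  Flips-Σ⁻¹ h []       (flip (flip end)) _   = ⊥-elim (diag≢3 m cox s h)
  Flips-Σ⁻¹ h (t ∷ ts) (keep c)          ≢b with Flips-Σ⁻¹ h ts c ≢b
  ... | _ , _ , c′ , refl = _ , _ , keep c′ , refl
  Flips-Σ⁻¹ h (t ∷ ts) (flip c)          ≢b with Flips-Σ⁻¹ h ts c ≢b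
  ... | _ , _ , c′ , refl = _ , _ , flip c′ , refl

  fibWord-shadows⇒Joined : ∀ ts → (∀ j → j < length ts → Shadow m (fibWord s ts) (suc (j * 2))) → Joined m s ts
  fibWord-shadows⇒Joined []       _       = []
  fibWord-shadows⇒Joined (t ∷ ts) shadows =
    firstBlock (shadows 0 (s≤s z≤n)) ∷ fibWord-shadows⇒Joined ts (λ j j<n → shadows (suc j) (s≤s j<n))
    where
      firstBlock : Shadow m (fibWord s (t ∷ ts)) 1 → m s t ≡ 3
      firstBlock (_ , _ , refl , refl , _ , e) = e

  fibWord-noEvenShadow⇒Linked : ∀ ts → Joined m s ts → (∀ k → ¬ Shadow m (fibWord s ts) (2 + k * 2)) →
    Linked _≢_ ts
  fibWord-noEvenShadow⇒Linked []            _       _      = []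
  fibWord-noEvenShadow⇒Linked (t ∷ [])      _       _      = [-]
  fibWord-noEvenShadow⇒Linked (t ∷ t′ ∷ ts) (h ∷ j) noEven =
    (λ t≡t′ → noEven 0 (straddling t≡t′)) ∷ fibWord-noEvenShadow⇒Linked (t′ ∷ ts) j (λ k → noEven (suc k))
    where
      straddling : t ≡ t′ → Shadow m (fibWord s (t ∷ t′ ∷ ts)) 2
      straddling refl = t , s , refl , refl , refl , trans (IsCoxeterMatrix.sym cox t s) h

  FibonacciLink⇒Joined×Linked : ∀ ts → FibonacciLink m (length ts) (fibWord s ts) → Joined m s ts × Linked _≢_ ts
  FibonacciLink⇒Joined×Linked ts ((_ , _ , link) , shadows) = joined , fibWord-noEvenShadow⇒Linked ts joined noEven
    where
      joined : Joined m s ts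
      joined = fibWord-shadows⇒Joined ts λ j j<n →
        subst (Shadow m (fibWord s ts)) (trans (+-comm (2 * j) 1) (cong suc (*-comm 2 j))) (shadows j j<n)
      noEven : ∀ k → ¬ Shadow m (fibWord s ts) (2 + k * 2)
      noEven k sh with proj₁ (link _) (_ , ε , sh)
      ... | j , _ , 2+2k≡2j+1 = even≢odd (suc k) j (trans (*-comm 2 (suc k)) (trans 2+2k≡2j+1 (+-comm (2 * j) 1)))

module Suffix {S : Set} (m : S → S → ℕ) (cox : IsCoxeterMatrix m) (tf : TriangleFree m) (s : S)
  (ts : List S) (a b : S) (joined : Joined m s (ts ++ a ∷ b ∷ [])) (linked : Linked _≢_ (ts ++ a ∷ b ∷ []))
  where

  φ φ′ w : List S
  φ  = fibWord s (ts ++ a ∷ b ∷ [])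
  φ′ = fibWord s ts
  w  = a ∷ b ∷ s ∷ b ∷ []

  s-a : m s a ≡ 3
  s-a with ++⁻ʳ ts joined
  ... | h ∷ _ = h

  s-b : m s b ≡ 3
  s-b with ++⁻ʳ ts joined
  ... | _ ∷ h ∷ _ = h

  s≢b : s ≢ b
  s≢b refl = diag≢3 m cox s s-b

  flipsOf : ∀ {α} → BraidClass m φ′ α → ∃ λ K → Flips s s ts K α
  flipsOf sα = BraidClass-Flips cox s tf (++⁻ˡ ts joined) (Linked-++⁻ˡ ts linked) sα (proj₂ (Flips-fibWord ts))

  Σ-BraidClass : ∀ α → BraidClass m φ′ α → BraidClass m φ (α ++ w)
  Σ-BraidClass α sα = subst (λ φ₀ → BraidClass m φ₀ (α ++ w)) (sym (fibWord-++ s ts a (b ∷ [])))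
    (BraidStep-++ˡ m φ′ (braid (a ∷ []) [] s b s-b) ◅ BraidClass-++ʳ m w sα)

  Σ-project : ∀ {α β j} → BraidClass m φ′ α → BraidClass m φ′ β →
    Walk m j (α ++ w) (β ++ w) → ∃ λ j′ → j′ ≤ j × Walk m j′ α β
  Σ-project sα sβ p with flipsOf sα | flipsOf sβ
  ... | _ , c | _ , c′ = Walk-project cox s ts tf joined linked p (Flips-Σ c) (Flips-Σ c′) (restrict c) (restrict c′)
    where
      restrict : ∀ {K α} → Flips s s ts K α → Flips s s ts (take (length ts) (K ++ false ∷ true ∷ [])) α
      restrict {K} c = subst (λ K₀ → Flips s s ts K₀ _)
        (sym (subst (λ n → take n (K ++ _) ≡ K) (Flips-length c) (take-length-++ K))) c

  Σ-Dist : ∀ α β → BraidClass m φ′ α → BraidClass m φ′ β → ∀ k →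
    (Dist m α β k → Dist m (α ++ w) (β ++ w) k) × (Dist m (α ++ w) (β ++ w) k → Dist m α β k)
  Σ-Dist α β sα sβ = Dist-transfer m (Walk-++ʳ m w) (Σ-project sα sβ)

  Σ-BraidStep : ∀ α β → BraidClass m φ′ α → BraidClass m φ′ β →
    (BraidStep m α β → BraidStep m (α ++ w) (β ++ w)) × (BraidStep m (α ++ w) (β ++ w) → BraidStep m α β)
  Σ-BraidStep α β sα sβ =
    BraidStep-++ʳ m w , λ st → Dist1⇒BraidStep m (proj₂ (Σ-Dist α β sα sβ 1) (BraidStep⇒Dist1 m cox st))

  Σ-image : ∀ γ → BraidClass m φ γ →
    (at m γ (2 * (length ts + 2)) ≢ just b → ∃ λ α → BraidClass m φ′ α × γ ≡ α ++ w) ×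
    ((∃ λ α → BraidClass m φ′ α × γ ≡ α ++ w) → at m γ (2 * (length ts + 2)) ≢ just b)
  Σ-image γ sγ = image , (λ { (α , sα , refl) → notB sα })
    where
      position : 2 * (length ts + 2) ≡ 4 + length ts * 2
      position = trans (*-comm 2 (length ts + 2)) (trans (*-distribʳ-+ 2 (length ts) 2) (+-comm (length ts * 2) 4))
      image : at m γ (2 * (length ts + 2)) ≢ just b → ∃ λ α → BraidClass m φ′ α × γ ≡ α ++ w
      image ≢b with BraidClass-Flips cox s tf joined linked sγ (proj₂ (Flips-fibWord (ts ++ a ∷ b ∷ [])))
      ... | _ , c with Flips-Σ⁻¹ cox s s-a ts c (λ e → ≢b (trans (cong (at m γ) position) e))
      ... | _ , α , d , γ≡αw = α , Flips⇒BraidClass cox s (++⁻ˡ ts joined) d , γ≡αw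
      notB : ∀ {α} → BraidClass m φ′ α → at m (α ++ w) (2 * (length ts + 2)) ≢ just b
      notB {α} sα e =
        s≢b (just-injective (trans (sym (Flips-Σ-at m (proj₂ (flipsOf sα)))) (trans (cong (at m (α ++ w)) (sym position)) e)))

proposition6p7 : {S : Set} (m : S → S → ℕ) → IsCoxeterMatrix m → SimplyLaced m → TriangleFree m →
    (s a b : S) (ts : List S) →
    FibonacciLink m (length ts + 2) (fibWord s (ts ++ a ∷ b ∷ [])) →
    ((α : List S) → BraidClass m (fibWord s ts) α →
       BraidClass m (fibWord s (ts ++ a ∷ b ∷ [])) (α ++ a ∷ b ∷ s ∷ b ∷ []))
    × ((α β : List S) → BraidClass m (fibWord s ts) α → BraidClass m (fibWord s ts) β → (k : ℕ) →
       (Dist m α β k → Dist m (α ++ a ∷ b ∷ s ∷ b ∷ []) (β ++ a ∷ b ∷ s ∷ b ∷ []) k)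
       × (Dist m (α ++ a ∷ b ∷ s ∷ b ∷ []) (β ++ a ∷ b ∷ s ∷ b ∷ []) k → Dist m α β k))
    × ((γ : List S) → BraidClass m (fibWord s (ts ++ a ∷ b ∷ [])) γ →
       (at m γ (2 * (length ts + 2)) ≢ just b →
          ∃ λ α → BraidClass m (fibWord s ts) α × γ ≡ α ++ a ∷ b ∷ s ∷ b ∷ [])
       × ((∃ λ α → BraidClass m (fibWord s ts) α × γ ≡ α ++ a ∷ b ∷ s ∷ b ∷ []) →
          at m γ (2 * (length ts + 2)) ≢ just b))
    × ((α β : List S) → BraidClass m (fibWord s ts) α → BraidClass m (fibWord s ts) β →
       (BraidStep m α β → BraidStep m (α ++ a ∷ b ∷ s ∷ b ∷ []) (β ++ a ∷ b ∷ s ∷ b ∷ []))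
       × (BraidStep m (α ++ a ∷ b ∷ s ∷ b ∷ []) (β ++ a ∷ b ∷ s ∷ b ∷ []) → BraidStep m α β))
proposition6p7 m cox _ tf s a b ts fibonacci = Σ-BraidClass , Σ-Dist , Σ-image , Σ-BraidStep
  where
    letters : Joined m s (ts ++ a ∷ b ∷ []) × Linked _≢_ (ts ++ a ∷ b ∷ [])
    letters = FibonacciLink⇒Joined×Linked cox s (ts ++ a ∷ b ∷ [])
      (subst (λ r → FibonacciLink m r (fibWord s (ts ++ a ∷ b ∷ []))) (sym (length-++ ts)) fibonacci)
    open Suffix m cox tf s ts a b (proj₁ letters) (proj₂ letters)
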